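{- If $G$ is a connected simple graph on $n\ge 2$ vertices with $p$ blocks, then $\mathrm{hn}_{cc}(G)\ge p+1$.
   Context: A block of a graph is a maximal connected subgraph without a cut-vertex. A cycle is a closed walk $(v_1,\dots,v_q,v_1)$ with at least one edge in which the only repeated vertex is $v_1$. For $S\subseteq V(G)$, $I_{cc}(S)=S\cup\{x\in V(G): \text{there is a cycle } C \text{ of } G \text{ with } V(C)\setminus S=\{x\}\}$. A set $X$ is convex if $I_{cc}(X)=X$; $\mathrm{hull}(X)$ is the smallest convex set containing $X$; $X$ is a hull set if $\mathrm{hull}(X)=V(G)$; $\mathrm{hn}_{cc}(G)$ is the minimum cardinality of a hull set. -}

module Defs where

open import Data.Nat using (ℕ; suc; _≤_; _+_)
open import Data.Fin using (Fin)
open import Data.Fin.Subset using (Subset; _∈_; _∉_; _⊆_; ∣_∣)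
open import Data.Bool using (Bool; true)
open import Data.Empty using (⊥)
open import Data.Unit using (⊤)
open import Data.List using (List; []; _∷_; length)
open import Data.List.Relation.Unary.All using (All)
open import Data.List.Relation.Unary.Unique.Propositional using (Unique)
import Data.List.Membership.Propositional as LM
open import Data.Product using (Σ; ∃; _×_; _,_)
open import Data.Sum using (_⊎_)
open import Relation.Binary.PropositionalEquality using (_≡_; _≢_)
open import Relation.Nullary using (¬_)

record Graph (n : ℕ) : Set where
  field
    adj        : Fin n → Fin n → Bool
    adj-sym    : ∀ u v → adj u v ≡ adj v u
    adj-irrefl : ∀ v → ¬ (adj v v ≡ true)
open Graph public

module _ {n : ℕ} (G : Graph n) where

  Adj : Fin n → Fin n → Set
  Adj u v = adj G u v ≡ true

  data WalkIn (P : Fin n → Set) : Fin n → Fin n → Set where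
    here : ∀ {u} → P u → WalkIn P u u
    step : ∀ {u w v} → P u → Adj u w → WalkIn P w v → WalkIn P u v

  Connected : Set
  Connected = ∀ u v → WalkIn (λ _ → ⊤) u v

  ConnectedIn : Subset n → Set
  ConnectedIn B = (∃ λ v → v ∈ B) × (∀ u v → u ∈ B → v ∈ B → WalkIn (_∈ B) u v)

  CutVertexIn : Subset n → Fin n → Set
  CutVertexIn B v = v ∈ B × (∃ λ u → ∃ λ w → u ∈ B × w ∈ B × u ≢ v × w ≢ v ×
                      ¬ WalkIn (λ x → x ∈ B × x ≢ v) u w)

  Biconn : Subset n → Set
  Biconn B = ConnectedIn B × (∀ v → ¬ CutVertexIn B v)

  -- A block: maximal connected subgraph without a cut-vertex (maximal such
  -- subgraphs are induced, so they are determined by their vertex sets).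
  IsBlock : Subset n → Set
  IsBlock B = Biconn B × (∀ B' → B ⊆ B' → Biconn B' → B' ⊆ B)

  HasBlocks : ℕ → Set
  HasBlocks p = ∃ λ (bs : List (Subset n)) → length bs ≡ p × Unique bs ×
                All IsBlock bs × (∀ B → IsBlock B → B LM.∈ bs)

  data PathAdj : List (Fin n) → Set where
    one  : ∀ {v} → PathAdj (v ∷ [])
    cons : ∀ {u v vs} → Adj u v → PathAdj (v ∷ vs) → PathAdj (u ∷ v ∷ vs)

  last : Fin n → List (Fin n) → Fin n
  last v []       = v
  last _ (w ∷ ws) = last w ws

  IsCycle : List (Fin n) → Set
  IsCycle []       = ⊥
  IsCycle (v ∷ vs) = 3 ≤ length (v ∷ vs) × Unique (v ∷ vs) ×
                     PathAdj (v ∷ vs) × Adj (last v vs) v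

  InIcc : Subset n → Fin n → Set
  InIcc S x = x ∈ S ⊎ (∃ λ (cs : List (Fin n)) → IsCycle cs × x LM.∈ cs × x ∉ S ×
                        (∀ y → y LM.∈ cs → y ≢ x → y ∈ S))

  -- X is convex: I_cc(X) = X (the inclusion X ⊆ I_cc(X) always holds).
  Convex : Subset n → Set
  Convex X = ∀ x → InIcc X x → x ∈ X

  -- hull(X) = V(G): the smallest convex set containing X (the intersection
  -- of all convex supersets of X) is the whole vertex set.
  IsHullSet : Subset n → Set
  IsHullSet X = ∀ C → X ⊆ C → Convex C → ∀ v → v ∈ C

  IsHullNumber : ℕ → Set
  IsHullNumber h = (∃ λ X → IsHullSet X × ∣ X ∣ ≡ h) ×
                   (∀ X → IsHullSet X → h ≤ ∣ X ∣)

-- Let excess(S) = Σ_B (|B ∩ S| − 2)⁺ over the blocks B. A vertex x that I_cc adds to S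
-- lies on a cycle whose other vertices, at least two of them, are in S; the cycle lies in a
-- single block, which thus already meets S twice, so adding x raises the excess by at least
-- one. Growing a hull set X under this invariant to a maximal, hence convex, set gives
-- n − |X| ≤ excess(V) − excess(X) ≤ Σ_B (|B| − 2).
-- On the other hand, fix a rooted spanning tree. In each block, every vertex but the one
-- nearest the root has its parent in the block too (the block plus the tree path between
-- the two would be a larger biconnected set), and two blocks share at most one vertex; so
-- the blocks with their top vertices removed are disjoint and miss the root, whence
-- Σ_B (|B| − 1) ≤ n − 1. Together these give |X| ≥ p + 1.
-- The classical steps (maximal sets, minima, comprehension) run in the double-negation
-- monad, which suffices because the conclusion is decidable.

module Submission where

open import Defs
open import Level using (0ℓ)
open import Function using (_∘_; _∘₂_; case_of_)
open import Data.Nat using (ℕ; zero; suc; _≤_; _<_; _+_; _∸_; z≤n; s≤s; _≤?_)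
open import Data.Nat.Properties
open import Data.Nat.Induction using (<-rec)
open import Data.Fin using (Fin; zero; suc) renaming (_≟_ to _≟ᶠ_)
open import Data.Fin.Subset using (Subset; _∈_; _∉_; _⊆_; _⊂_; _⊃_; ∣_∣; _∩_; _∪_; ⊤; ⁅_⁆)
open import Data.Fin.Subset using () renaming (⊥ to ∅)
open import Data.Fin.Subset.Properties
open import Data.Fin.Subset.Induction using (⊃-wellFounded; Acc; acc)
open import Data.Vec using ([]; _∷_; here; there; tabulate)
open import Data.Vec.Properties using (lookup∘tabulate; []=⇒lookup; lookup⇒[]=)
open import Data.Bool using (true; false)
open import Data.Empty using (⊥-elim)
open import Data.Unit using () renaming (⊤ to Unit)
open import Data.List using (List; []; _∷_; length)
open import Data.List.Membership.Propositional using () renaming (_∈_ to _∈ₗ_)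
import Data.List.Membership.DecPropositional as DecMembership
open import Data.List.Relation.Unary.Any using (here; there)
open import Data.List.Relation.Unary.All using (All; []; _∷_)
import Data.List.Relation.Unary.All as All
open import Data.List.Relation.Unary.AllPairs using ([]; _∷_)
open import Data.List.Relation.Unary.Unique.Propositional using (Unique)
open import Data.Product using (∃; ∃₂; _×_; _,_; proj₁; proj₂)
open import Data.Sum using (_⊎_; inj₁; inj₂)
import Data.Sum as Sum
open import Effect.Monad using (RawMonad)
open import Relation.Binary using (TotalPreorder)
import Relation.Binary.Construct.Flip.EqAndOrd as Flip
open import Relation.Binary.PropositionalEquality using (_≡_; _≢_; refl; sym; trans; cong; subst)
open import Relation.Nullary using (¬_; yes; no; does)
open import Relation.Nullary.Decidable using (_×-dec_; ¬?; decidable-stable; ¬¬-excluded-middle; dec-true)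
open import Relation.Nullary.Negation using (¬¬-Monad)
open import Relation.Unary using (Pred; Decidable; _≐_)

open RawMonad (¬¬-Monad {a = 0ℓ}) using (pure; _>>=_)

¬¬-finite-choice : ∀ {n} {A : Fin n → Set} → (∀ i → ¬ ¬ A i) → ¬ ¬ (∀ i → A i)
¬¬-finite-choice {zero}  _ = pure λ ()
¬¬-finite-choice {suc n} f = do
  a₀ ← f zero
  as ← ¬¬-finite-choice (f ∘ suc)
  pure λ { zero → a₀ ; (suc i) → as i }

comprehension : ∀ {n} {P : Pred (Fin n) 0ℓ} → Decidable P → ∃ λ S → (_∈ S) ≐ P
comprehension {P = P} P? = S , sound , complete
  where
  S = tabulate (does ∘ P?)
  sound : ∀ {x} → x ∈ S → P x
  sound {x} x∈S with P? x | trans (sym (lookup∘tabulate (does ∘ P?) x)) ([]=⇒lookup x∈S)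
  ... | yes px | _  = px
  ... | no _   | ()
  complete : ∀ {x} → P x → x ∈ S
  complete {x} px = lookup⇒[]= x S (trans (lookup∘tabulate (does ∘ P?) x) (dec-true (P? x) px))

¬¬-comprehension : ∀ {n} (P : Pred (Fin n) 0ℓ) → ¬ ¬ ∃ λ S → (_∈ S) ≐ P
¬¬-comprehension P = do
  P? ← ¬¬-finite-choice (λ _ → ¬¬-excluded-middle)
  pure (comprehension P?)

¬¬-least : {P : Pred ℕ 0ℓ} → ∃ P → ¬ ¬ ∃ λ m → P m × ∀ {k} → P k → m ≤ k
¬¬-least {P} (k , pk) = <-rec (λ k → P k → ¬ ¬ Least) search k pk
  where
  Least = ∃ λ m → P m × ∀ {i} → P i → m ≤ i
  search : ∀ k → (∀ {j} → j < k → P j → ¬ ¬ Least) → P k → ¬ ¬ Least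
  search k below pk = do
    smaller? ← ¬¬-excluded-middle {A = ∃ λ j → j < k × P j}
    case smaller? of λ where
      (yes (j , j<k , pj)) → below j<k pj
      (no none)            → pure (k , pk , λ {i} pi → ≮⇒≥ λ i<k → none (i , i<k , pi))

module _ (O : TotalPreorder 0ℓ 0ℓ 0ℓ) where
  open TotalPreorder O using (_≲_)
    renaming (Carrier to W; refl to ≲-refl; trans to ≲-trans; total to ≲-total)

  ¬¬-argmin : ∀ {n} {P : Pred (Fin n) 0ℓ} (w : Fin n → W) → ∃ P →
              ¬ ¬ ∃ λ c → P c × ∀ {c′} → P c′ → w c ≲ w c′
  ¬¬-argmin {suc n} {P} w (c₀ , pc₀) = do
    P0? ← ¬¬-excluded-middle {A = P zero}
    Psuc? ← ¬¬-excluded-middle {A = ∃ (P ∘ suc)}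
    case Psuc? of λ where
      (no none)  →
        pure (zero , only-zero none c₀ pc₀ , λ { {zero} _ → ≲-refl ; {suc c} pc → ⊥-elim (none (c , pc)) })
      (yes some) → do
        (m , pm , m-min) ← ¬¬-argmin (w ∘ suc) some
        pure (case P0? of λ where
          (no ¬p0) → suc m , pm , λ { {zero} p0 → ⊥-elim (¬p0 p0) ; {suc c} pc → m-min pc }
          (yes p0) → case ≲-total (w zero) (w (suc m)) of λ where
            (inj₁ 0≲m) → zero , p0 , λ { {zero} _ → ≲-refl ; {suc c} pc → ≲-trans 0≲m (m-min pc) }
            (inj₂ m≲0) → suc m , pm , λ { {zero} _ → m≲0 ; {suc c} pc → m-min pc })
    where
    only-zero : ¬ ∃ (P ∘ suc) → ∀ c → P c → P zero
    only-zero _    zero    pz = pz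
    only-zero none (suc c) pc = ⊥-elim (none (c , pc))

∣p∪q∣≤∣p∣+∣q∣ : ∀ {n} (p q : Subset n) → ∣ p ∪ q ∣ ≤ ∣ p ∣ + ∣ q ∣
∣p∪q∣≤∣p∣+∣q∣ []          []          = z≤n
∣p∪q∣≤∣p∣+∣q∣ (true ∷ p)  (true ∷ q)  = s≤s (≤-trans (∣p∪q∣≤∣p∣+∣q∣ p q) (+-monoʳ-≤ ∣ p ∣ (n≤1+n _)))
∣p∪q∣≤∣p∣+∣q∣ (true ∷ p)  (false ∷ q) = s≤s (∣p∪q∣≤∣p∣+∣q∣ p q)
∣p∪q∣≤∣p∣+∣q∣ (false ∷ p) (true ∷ q)  = ≤-trans (s≤s (∣p∪q∣≤∣p∣+∣q∣ p q)) (≤-reflexive (sym (+-suc _ _)))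
∣p∪q∣≤∣p∣+∣q∣ (false ∷ p) (false ∷ q) = ∣p∪q∣≤∣p∣+∣q∣ p q

∣p∪⁅x⁆∣≤1+∣p∣ : ∀ {n} (p : Subset n) (x : Fin n) → ∣ p ∪ ⁅ x ⁆ ∣ ≤ suc ∣ p ∣
∣p∪⁅x⁆∣≤1+∣p∣ p x = begin
  ∣ p ∪ ⁅ x ⁆ ∣     ≤⟨ ∣p∪q∣≤∣p∣+∣q∣ p ⁅ x ⁆ ⟩
  ∣ p ∣ + ∣ ⁅ x ⁆ ∣ ≡⟨ cong (∣ p ∣ +_) (∣⁅x⁆∣≡1 x) ⟩
  ∣ p ∣ + 1         ≡⟨ +-comm ∣ p ∣ 1 ⟩
  suc ∣ p ∣         ∎
  where open ≤-Reasoning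

⊆∪⁅x⁆⇒∣p∣≤1+∣q∣ : ∀ {n} {p q : Subset n} {x} → (∀ {y} → y ∈ p → y ≢ x → y ∈ q) → ∣ p ∣ ≤ suc ∣ q ∣
⊆∪⁅x⁆⇒∣p∣≤1+∣q∣ {p = p} {q} {x} p-x⊆q = ≤-trans (p⊆q⇒∣p∣≤∣q∣ p⊆q∪⁅x⁆) (∣p∪⁅x⁆∣≤1+∣p∣ q x)
  where
  p⊆q∪⁅x⁆ : p ⊆ q ∪ ⁅ x ⁆
  p⊆q∪⁅x⁆ {y} y∈p with y ≟ᶠ x
  ... | yes refl = q⊆p∪q q ⁅ x ⁆ (x∈⁅x⁆ x)
  ... | no y≢x   = p⊆p∪q ⁅ x ⁆ (p-x⊆q y∈p y≢x)

disjoint⇒∣p∣+∣q∣≤∣p∪q∣ : ∀ {n} (p q : Subset n) → (∀ {x} → x ∈ p → x ∉ q) → ∣ p ∣ + ∣ q ∣ ≤ ∣ p ∪ q ∣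
disjoint⇒∣p∣+∣q∣≤∣p∪q∣ []          []          _ = z≤n
disjoint⇒∣p∣+∣q∣≤∣p∪q∣ (true ∷ p)  (true ∷ q)  d = ⊥-elim (d here here)
disjoint⇒∣p∣+∣q∣≤∣p∪q∣ (true ∷ p)  (false ∷ q) d =
  s≤s (disjoint⇒∣p∣+∣q∣≤∣p∪q∣ p q λ x∈p → d (there x∈p) ∘ there)
disjoint⇒∣p∣+∣q∣≤∣p∪q∣ (false ∷ p) (true ∷ q)  d =
  ≤-trans (≤-reflexive (+-suc _ _)) (s≤s (disjoint⇒∣p∣+∣q∣≤∣p∪q∣ p q λ x∈p → d (there x∈p) ∘ there))
disjoint⇒∣p∣+∣q∣≤∣p∪q∣ (false ∷ p) (false ∷ q) d =
  disjoint⇒∣p∣+∣q∣≤∣p∪q∣ p q λ x∈p → d (there x∈p) ∘ there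

2≤∣p∣ : ∀ {n} {p : Subset n} {x y : Fin n} → x ≢ y → x ∈ p → y ∈ p → 2 ≤ ∣ p ∣
2≤∣p∣ {p = p} {x} {y} x≢y x∈p y∈p =
  subst (_< ∣ p ∣) (∣⁅x⁆∣≡1 x) (p⊂q⇒∣p∣<∣q∣ (⁅x⁆⊆p , y , y∈p , x≢y⇒x∉⁅y⁆ (x≢y ∘ sym)))
  where
  ⁅x⁆⊆p : ⁅ x ⁆ ⊆ p
  ⁅x⁆⊆p z∈⁅x⁆ = subst (_∈ p) (sym (x∈⁅y⁆⇒x≡y x z∈⁅x⁆)) x∈p

¬¬-maximal : ∀ {n} (Q : Pred (Subset n) 0ℓ) {S : Subset n} → Q S →
             ¬ ¬ ∃ λ M → S ⊆ M × Q M × ∀ M′ → M ⊆ M′ → Q M′ → M′ ⊆ M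
¬¬-maximal Q {S} qS = grow (⊃-wellFounded S) qS
  where
  grow : ∀ {S} → Acc _⊃_ S → Q S → ¬ ¬ ∃ λ M → S ⊆ M × Q M × ∀ M′ → M ⊆ M′ → Q M′ → M′ ⊆ M
  grow {S} (acc larger) qS = do
    extensible? ← ¬¬-excluded-middle {A = ∃ λ T → S ⊂ T × Q T}
    case extensible? of λ where
      (yes (T , S⊂T , qT)) → do
        (M , T⊆M , qM , M-max) ← grow (larger S⊂T) qT
        pure (M , (λ {x} x∈S → T⊆M (proj₁ S⊂T x∈S)) , qM , M-max)
      (no none) → pure (S , (λ {x} x∈S → x∈S) , qS , λ M′ S⊆M′ qM′ {x} x∈M′ →
        decidable-stable (x ∈? S) λ x∉S → none (M′ , ((λ {y} → S⊆M′ {y}) , x , x∈M′ , x∉S) , qM′))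

module Walks {n : ℕ} (G : Graph n) where

  Adj-sym : ∀ {u v} → Adj G u v → Adj G v u
  Adj-sym {u} {v} uv = trans (adj-sym G v u) uv

  mapʷ : ∀ {P Q : Pred (Fin n) 0ℓ} → (∀ {x} → P x → Q x) → ∀ {u v} → WalkIn G P u v → WalkIn G Q u v
  mapʷ f (here pu)      = here (f pu)
  mapʷ f (step pu uw w) = step (f pu) uw (mapʷ f w)

  endʷ : ∀ {P u v} → WalkIn G P u v → P v
  endʷ (here pv)    = pv
  endʷ (step _ _ w) = endʷ w

  _++ʷ_ : ∀ {P u v w} → WalkIn G P u v → WalkIn G P v w → WalkIn G P u w
  here _       ++ʷ w′ = w′
  step pu uw w ++ʷ w′ = step pu uw (w ++ʷ w′)

  _∷ʳʷ_ : ∀ {P u v w} → WalkIn G P u v → Adj G v w × P w → WalkIn G P u w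
  walk ∷ʳʷ (vw , pw) = walk ++ʷ step (endʷ walk) vw (here pw)

  lengthʷ : ∀ {P u v} → WalkIn G P u v → ℕ
  lengthʷ (here _)     = 0
  lengthʷ (step _ _ w) = suc (lengthʷ w)

  reverseʷ : ∀ {P u v} → WalkIn G P u v → WalkIn G P v u
  reverseʷ (here pu)      = here pu
  reverseʷ (step pu uw w) = reverseʷ w ∷ʳʷ (Adj-sym uw , pu)

  ∃-neighbour : ∀ {P u v} → WalkIn G P u v → u ≢ v → ∃ (Adj G u)
  ∃-neighbour (here _)      u≢u = ⊥-elim (u≢u refl)
  ∃-neighbour (step _ uw _) _   = _ , uw

module Biconnectivity {n : ℕ} (G : Graph n) where
  open Walks G

  Biconn⇒¬¬walk-avoiding : ∀ {B} → Biconn G B → ∀ w {y s} → y ∈ B → s ∈ B → y ≢ w → s ≢ w →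
                            ¬ ¬ WalkIn G (λ x → x ∈ B × x ≢ w) y s
  Biconn⇒¬¬walk-avoiding {B} ((_ , conn) , no-cut) w {y} {s} y∈B s∈B y≢w s≢w with w ∈? B
  ... | yes w∈B = λ no-walk → no-cut w (w∈B , y , s , y∈B , s∈B , y≢w , s≢w , no-walk)
  ... | no  w∉B = pure (mapʷ (λ {x} x∈B → x∈B , λ { refl → w∉B x∈B }) (conn y s y∈B s∈B))

  Biconn-extend : ∀ {B D} → Biconn G B → B ⊆ D →
    (∀ {y} → y ∈ D → ∃ λ z → z ∈ B × WalkIn G (_∈ D) y z) →
    (∀ w {y} → y ∈ D → y ≢ w → ¬ ¬ ∃ λ z → z ∈ B × z ≢ w × WalkIn G (λ x → x ∈ D × x ≢ w) y z) →
    Biconn G D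
  Biconn-extend {B} {D} B-bi@(((v , v∈B) , conn) , _) B⊆D reach reach-avoiding =
    ((v , B⊆D v∈B) , connected) , no-cut
    where
    connected : ∀ u w → u ∈ D → w ∈ D → WalkIn G (_∈ D) u w
    connected u w u∈D w∈D with reach u∈D | reach w∈D
    ... | (z₁ , z₁∈B , u⇝z₁) | (z₂ , z₂∈B , w⇝z₂) =
      u⇝z₁ ++ʷ (mapʷ B⊆D (conn z₁ z₂ z₁∈B z₂∈B) ++ʷ reverseʷ w⇝z₂)
    no-cut : ∀ v → ¬ CutVertexIn G D v
    no-cut v (_ , u , w , u∈D , w∈D , u≢v , w≢v , no-walk) = walk no-walk
      where
      walk : ¬ ¬ WalkIn G (λ x → x ∈ D × x ≢ v) u w
      walk = do
        (z₁ , z₁∈B , z₁≢v , u⇝z₁) ← reach-avoiding v u∈D u≢v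
        (z₂ , z₂∈B , z₂≢v , w⇝z₂) ← reach-avoiding v w∈D w≢v
        z₁⇝z₂ ← Biconn⇒¬¬walk-avoiding B-bi v z₁∈B z₂∈B z₁≢v z₂≢v
        pure (u⇝z₁ ++ʷ (mapʷ (λ (x∈B , x≢v) → B⊆D x∈B , x≢v) z₁⇝z₂ ++ʷ reverseʷ w⇝z₂))

  edge-Biconn : ∀ {a b} → Adj G a b → Biconn G (⁅ a ⁆ ∪ ⁅ b ⁆)
  edge-Biconn {a} {b} ab = ((a , x∈p∪q⁺ (inj₁ (x∈⁅x⁆ a))) , connected) , no-cut
    where
    E = ⁅ a ⁆ ∪ ⁅ b ⁆
    endpoint : ∀ {x} → x ∈ E → x ≡ a ⊎ x ≡ b
    endpoint x∈E = Sum.map (x∈⁅y⁆⇒x≡y a) (x∈⁅y⁆⇒x≡y b) (x∈p∪q⁻ ⁅ a ⁆ ⁅ b ⁆ x∈E)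
    walk : ∀ {P : Pred (Fin n) 0ℓ} {x y} → x ∈ E → y ∈ E → P x → P y → WalkIn G P x y
    walk x∈E y∈E px py with endpoint x∈E | endpoint y∈E
    ... | inj₁ refl | inj₁ refl = here px
    ... | inj₁ refl | inj₂ refl = step px ab (here py)
    ... | inj₂ refl | inj₁ refl = step px (Adj-sym ab) (here py)
    ... | inj₂ refl | inj₂ refl = here px
    connected : ∀ u w → u ∈ E → w ∈ E → WalkIn G (_∈ E) u w
    connected u w u∈E w∈E = walk u∈E w∈E u∈E w∈E
    no-cut : ∀ v → ¬ CutVertexIn G E v
    no-cut v (_ , u , w , u∈E , w∈E , u≢v , w≢v , no-walk) =
      no-walk (walk u∈E w∈E (u∈E , u≢v) (w∈E , w≢v))

  walk-to-last : ∀ {q qs y} → PathAdj G (q ∷ qs) → y ∈ₗ q ∷ qs →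
                 WalkIn G (_∈ₗ q ∷ qs) y (last G q qs)
  walk-to-last {qs = []}    one             (here refl) = here (here refl)
  walk-to-last {qs = _ ∷ _} (cons qq′ path) (here refl) =
    step (here refl) qq′ (mapʷ there (walk-to-last path (here refl)))
  walk-to-last {qs = _ ∷ _} (cons _ path)   (there y∈)  = mapʷ there (walk-to-last path y∈)

  reach-path-end-avoiding : ∀ {q qs y w} → Unique (q ∷ qs) → PathAdj G (q ∷ qs) → y ∈ₗ q ∷ qs → y ≢ w →
    WalkIn G (λ z → z ∈ₗ q ∷ qs × z ≢ w) y q ⊎ WalkIn G (λ z → z ∈ₗ q ∷ qs × z ≢ w) y (last G q qs)
  reach-path-end-avoiding _ _ (here refl) y≢w = inj₁ (here (here refl , y≢w))
  reach-path-end-avoiding {q} {_ ∷ _} {w = w} (q∉qs ∷ unique) (cons qq′ path) (there y∈) y≢w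
    with w ≟ᶠ q
  ... | yes refl = inj₂ (mapʷ (λ z∈ → there z∈ , λ { refl → All.lookup q∉qs z∈ refl }) (walk-to-last path y∈))
  ... | no w≢q with reach-path-end-avoiding unique path y∈ y≢w
  ...   | inj₁ y⇝q′  = inj₁ (mapʷ (λ (z∈ , z≢w) → there z∈ , z≢w) y⇝q′ ∷ʳʷ (Adj-sym qq′ , here refl , w≢q ∘ sym))
  ...   | inj₂ y⇝end = inj₂ (mapʷ (λ (z∈ , z≢w) → there z∈ , z≢w) y⇝end)

  cycle-Biconn : ∀ {cs K} → IsCycle G cs → (_∈ K) ≐ (_∈ₗ cs) → Biconn G K
  cycle-Biconn {c ∷ cs} {K} (_ , unique , path , closing) (K⊆cs , cs⊆K) =
    ((c , cs⊆K (here refl)) , connected) , no-cut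
    where
    connected : ∀ u w → u ∈ K → w ∈ K → WalkIn G (_∈ K) u w
    connected u w u∈K w∈K =
      mapʷ cs⊆K (walk-to-last path (K⊆cs u∈K) ++ʷ reverseʷ (walk-to-last path (K⊆cs w∈K)))
    no-cut : ∀ v → ¬ CutVertexIn G K v
    no-cut v (_ , u , w , u∈K , w∈K , u≢v , w≢v , no-walk) =
      no-walk (mapʷ (λ (x∈cs , x≢v) → cs⊆K x∈cs , x≢v) around)
      where
      around : WalkIn G (λ x → x ∈ₗ c ∷ cs × x ≢ v) u w
      around with reach-path-end-avoiding unique path (K⊆cs u∈K) u≢v
                | reach-path-end-avoiding unique path (K⊆cs w∈K) w≢v
      ... | inj₁ u⇝c   | inj₁ w⇝c   = u⇝c ++ʷ reverseʷ w⇝c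
      ... | inj₂ u⇝end | inj₂ w⇝end = u⇝end ++ʷ reverseʷ w⇝end
      ... | inj₁ u⇝c   | inj₂ w⇝end = (u⇝c ∷ʳʷ (Adj-sym closing , endʷ w⇝end)) ++ʷ reverseʷ w⇝end
      ... | inj₂ u⇝end | inj₁ w⇝c   = (u⇝end ∷ʳʷ (closing , endʷ w⇝c)) ++ʷ reverseʷ w⇝c

  ¬¬-block-⊇ : ∀ {E} → Biconn G E → ¬ ¬ ∃ λ B → IsBlock G B × E ⊆ B
  ¬¬-block-⊇ E-bi = do
    (B , E⊆B , B-bi , B-max) ← ¬¬-maximal (Biconn G) E-bi
    pure (B , (B-bi , B-max) , λ {x} → E⊆B {x})

  two-common-vertices⇒⊆ : ∀ {B₁ B₂ s t} → IsBlock G B₁ → IsBlock G B₂ → s ≢ t →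
                          s ∈ B₁ → t ∈ B₁ → s ∈ B₂ → t ∈ B₂ → B₂ ⊆ B₁
  two-common-vertices⇒⊆ {B₁} {B₂} {s} {t} (B₁-bi , B₁-max) (B₂-bi@((_ , conn₂) , _) , _)
                        s≢t s∈B₁ t∈B₁ s∈B₂ t∈B₂ =
    ⊆-trans (q⊆p∪q B₁ B₂) (B₁-max (B₁ ∪ B₂) (p⊆p∪q B₂) union-bi)
    where
    reach : ∀ {y} → y ∈ B₁ ∪ B₂ → ∃ λ z → z ∈ B₁ × WalkIn G (_∈ B₁ ∪ B₂) y z
    reach {y} y∈D with x∈p∪q⁻ B₁ B₂ y∈D
    ... | inj₁ y∈B₁ = y , y∈B₁ , here y∈D
    ... | inj₂ y∈B₂ = s , s∈B₁ , mapʷ (q⊆p∪q B₁ B₂) (conn₂ y s y∈B₂ s∈B₂)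
    via-B₂ : ∀ {w y z} → z ∈ B₁ → z ∈ B₂ → y ∈ B₂ → y ≢ w → z ≢ w →
             ¬ ¬ ∃ λ z → z ∈ B₁ × z ≢ w × WalkIn G (λ x → x ∈ B₁ ∪ B₂ × x ≢ w) y z
    via-B₂ {w} {z = z} z∈B₁ z∈B₂ y∈B₂ y≢w z≢w = do
      y⇝z ← Biconn⇒¬¬walk-avoiding B₂-bi w y∈B₂ z∈B₂ y≢w z≢w
      pure (z , z∈B₁ , z≢w , mapʷ (λ (x∈B₂ , x≢w) → q⊆p∪q B₁ B₂ x∈B₂ , x≢w) y⇝z)
    reach-avoiding : ∀ w {y} → y ∈ B₁ ∪ B₂ → y ≢ w →
                     ¬ ¬ ∃ λ z → z ∈ B₁ × z ≢ w × WalkIn G (λ x → x ∈ B₁ ∪ B₂ × x ≢ w) y z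
    reach-avoiding w {y} y∈D y≢w with x∈p∪q⁻ B₁ B₂ y∈D | s ≟ᶠ w
    ... | inj₁ y∈B₁ | _        = pure (y , y∈B₁ , y≢w , here (y∈D , y≢w))
    ... | inj₂ y∈B₂ | no s≢w   = via-B₂ s∈B₁ s∈B₂ y∈B₂ y≢w s≢w
    ... | inj₂ y∈B₂ | yes refl = via-B₂ t∈B₁ t∈B₂ y∈B₂ y≢w (s≢t ∘ sym)
    union-bi : Biconn G (B₁ ∪ B₂)
    union-bi = Biconn-extend B₁-bi (p⊆p∪q B₂) reach reach-avoiding

  two-common-vertices⇒≡ : ∀ {B₁ B₂ s t} → IsBlock G B₁ → IsBlock G B₂ → s ≢ t →
                          s ∈ B₁ → t ∈ B₁ → s ∈ B₂ → t ∈ B₂ → B₁ ≡ B₂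
  two-common-vertices⇒≡ B₁-block B₂-block s≢t s∈B₁ t∈B₁ s∈B₂ t∈B₂ =
    ⊆-antisym (two-common-vertices⇒⊆ B₂-block B₁-block s≢t s∈B₂ t∈B₂ s∈B₁ t∈B₁)
              (two-common-vertices⇒⊆ B₁-block B₂-block s≢t s∈B₁ t∈B₁ s∈B₂ t∈B₂)

  block-size≥2 : ∀ {B v w} → IsBlock G B → v ∈ B → Adj G v w → 2 ≤ ∣ B ∣
  block-size≥2 {B} {v} {w} (_ , B-max) v∈B vw = decidable-stable (2 ≤? ∣ B ∣) do
    second? ← ¬¬-excluded-middle {A = ∃ λ y → y ∈ B × y ≢ v}
    case second? of λ where
      (yes (y , y∈B , y≢v)) → pure (2≤∣p∣ y≢v y∈B v∈B)
      (no only-v) → λ _ → only-v (w , w∈B only-v , λ { refl → adj-irrefl G v vw })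
    where
    w∈B : ¬ (∃ λ y → y ∈ B × y ≢ v) → w ∈ B
    w∈B only-v = B-max (⁅ v ⁆ ∪ ⁅ w ⁆) B⊆edge (edge-Biconn vw) (q⊆p∪q ⁅ v ⁆ ⁅ w ⁆ (x∈⁅x⁆ w))
      where
      B⊆edge : B ⊆ ⁅ v ⁆ ∪ ⁅ w ⁆
      B⊆edge {y} y∈B with y ≟ᶠ v
      ... | yes refl = p⊆p∪q ⁅ w ⁆ (x∈⁅x⁆ v)
      ... | no y≢v   = ⊥-elim (only-v (y , y∈B , y≢v))

excess : ∀ {n} → List (Subset n) → Subset n → ℕ
excess []       S = 0
excess (B ∷ bs) S = (∣ B ∩ S ∣ ∸ 2) + excess bs S

module _ {n : ℕ} where

  ∩-monoʳ-⊆ : ∀ (B : Subset n) {S S′} → S ⊆ S′ → B ∩ S ⊆ B ∩ S′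
  ∩-monoʳ-⊆ B {S} S⊆S′ x∈B∩S = let (x∈B , x∈S) = x∈p∩q⁻ B S x∈B∩S in x∈p∩q⁺ (x∈B , S⊆S′ x∈S)

  excess-mono : ∀ bs {S S′ : Subset n} → S ⊆ S′ → excess bs S ≤ excess bs S′
  excess-mono []       S⊆S′ = z≤n
  excess-mono (B ∷ bs) S⊆S′ =
    +-mono-≤ (∸-monoˡ-≤ 2 (p⊆q⇒∣p∣≤∣q∣ (∩-monoʳ-⊆ B S⊆S′))) (excess-mono bs S⊆S′)

  excess-step : ∀ bs {B S S′ x} → B ∈ₗ bs → S ⊆ S′ → x ∈ B → x ∈ S′ → x ∉ S → 2 ≤ ∣ B ∩ S ∣ →
                suc (excess bs S) ≤ excess bs S′
  excess-step (B ∷ bs) {S = S} {S′} (here refl) S⊆S′ x∈B x∈S′ x∉S 2≤ =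
    +-mono-≤ (∸2-mono-< 2≤ (p⊂q⇒∣p∣<∣q∣ B∩S⊂B∩S′)) (excess-mono bs S⊆S′)
    where
    ∸2-mono-< : ∀ {a b} → 2 ≤ a → a < b → suc (a ∸ 2) ≤ b ∸ 2
    ∸2-mono-< (s≤s (s≤s _)) (s≤s (s≤s a<b)) = a<b
    B∩S⊂B∩S′ : B ∩ S ⊂ B ∩ S′
    B∩S⊂B∩S′ = ∩-monoʳ-⊆ B S⊆S′ , _ , x∈p∩q⁺ (x∈B , x∈S′) , x∉S ∘ proj₂ ∘ x∈p∩q⁻ B S
  excess-step (B ∷ bs) (there B∈bs) S⊆S′ x∈B x∈S′ x∉S 2≤ =
    ≤-trans (≤-reflexive (sym (+-suc _ _)))
            (+-mono-≤ (∸-monoˡ-≤ 2 (p⊆q⇒∣p∣≤∣q∣ (∩-monoʳ-⊆ B S⊆S′)))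
                      (excess-step bs B∈bs S⊆S′ x∈B x∈S′ x∉S 2≤))

module HullBound {n : ℕ} (G : Graph n) (bs : List (Subset n))
                 (complete : ∀ B → IsBlock G B → B ∈ₗ bs) where
  open Biconnectivity G
  open DecMembership (_≟ᶠ_ {n}) using () renaming (_∈?_ to _∈ₗ?_)

  cycle-two-others : ∀ {cs} → IsCycle G cs → ∀ x →
                     ∃₂ λ a b → a ∈ₗ cs × b ∈ₗ cs × a ≢ x × b ≢ x × a ≢ b
  cycle-two-others {v₁ ∷ v₂ ∷ v₃ ∷ _} (_ , ((v₁≢v₂ ∷ v₁≢v₃ ∷ _) ∷ (v₂≢v₃ ∷ _) ∷ _) , _) x
    with x ≟ᶠ v₁ | x ≟ᶠ v₂
  ... | yes refl | _        = v₂ , v₃ , there (here refl) , there (there (here refl)) ,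
                              v₁≢v₂ ∘ sym , v₁≢v₃ ∘ sym , v₂≢v₃
  ... | no x≢v₁  | yes refl = v₁ , v₃ , here refl , there (there (here refl)) , v₁≢v₂ , v₂≢v₃ ∘ sym , v₁≢v₃
  ... | no x≢v₁  | no x≢v₂  = v₁ , v₂ , here refl , there (here refl) , x≢v₁ ∘ sym , x≢v₂ ∘ sym , v₁≢v₂
  cycle-two-others {_ ∷ []}     (s≤s () , _) _
  cycle-two-others {_ ∷ _ ∷ []} (s≤s (s≤s ()) , _) _

  ¬¬-block-meeting-twice : ∀ {S x} → InIcc G S x → x ∉ S → ¬ ¬ ∃ λ B → B ∈ₗ bs × x ∈ B × 2 ≤ ∣ B ∩ S ∣
  ¬¬-block-meeting-twice (inj₁ x∈S) x∉S = ⊥-elim (x∉S x∈S)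
  ¬¬-block-meeting-twice {S} {x} (inj₂ (cs , cycle , x∈cs , _ , others∈S)) _ = do
    let (K , K≐cs) = comprehension (_∈ₗ? cs)
        (a , b , a∈cs , b∈cs , a≢x , b≢x , a≢b) = cycle-two-others cycle x
    (B , B-block , K⊆B) ← ¬¬-block-⊇ (cycle-Biconn cycle K≐cs)
    let on-B : ∀ {y} → y ∈ₗ cs → y ∈ B
        on-B y∈cs = K⊆B (proj₂ K≐cs y∈cs)
        on-B∩S : ∀ {y} → y ∈ₗ cs → y ≢ x → y ∈ B ∩ S
        on-B∩S {y} y∈cs y≢x = x∈p∩q⁺ (on-B y∈cs , others∈S y y∈cs y≢x)
    pure (B , complete B B-block , on-B x∈cs , 2≤∣p∣ a≢b (on-B∩S a∈cs a≢x) (on-B∩S b∈cs b≢x))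

  -- Every vertex of S outside X is paid for by one unit of excess.
  Controlled : Subset n → Subset n → Set
  Controlled X S = X ⊆ S × ∣ S ∣ + excess bs X ≤ ∣ X ∣ + excess bs S

  Controlled-∪⁅⁆ : ∀ {X S B x} → Controlled X S → B ∈ₗ bs → x ∈ B → x ∉ S → 2 ≤ ∣ B ∩ S ∣ →
                   Controlled X (S ∪ ⁅ x ⁆)
  Controlled-∪⁅⁆ {X} {S} {B} {x} (X⊆S , bound) B∈bs x∈B x∉S 2≤ = p⊆p∪q ⁅ x ⁆ ∘ X⊆S , (begin
    ∣ S ∪ ⁅ x ⁆ ∣ + excess bs X   ≤⟨ +-monoˡ-≤ (excess bs X) (∣p∪⁅x⁆∣≤1+∣p∣ S x) ⟩
    suc (∣ S ∣ + excess bs X)     ≤⟨ s≤s bound ⟩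
    suc (∣ X ∣ + excess bs S)     ≡⟨ +-suc ∣ X ∣ (excess bs S) ⟨
    ∣ X ∣ + suc (excess bs S)     ≤⟨ +-monoʳ-≤ ∣ X ∣ gain ⟩
    ∣ X ∣ + excess bs (S ∪ ⁅ x ⁆) ∎)
    where
    open ≤-Reasoning
    gain : suc (excess bs S) ≤ excess bs (S ∪ ⁅ x ⁆)
    gain = excess-step bs B∈bs (p⊆p∪q ⁅ x ⁆) x∈B (q⊆p∪q S ⁅ x ⁆ (x∈⁅x⁆ x)) x∉S 2≤

  maximal-Controlled⇒Convex : ∀ {X M} → Controlled X M → (∀ M′ → M ⊆ M′ → Controlled X M′ → M′ ⊆ M) →
                              Convex G M
  maximal-Controlled⇒Convex {X} {M} M-ctrl M-max x x∈I = decidable-stable (x ∈? M) λ x∉M → (do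
    (B , B∈bs , x∈B , 2≤) ← ¬¬-block-meeting-twice x∈I x∉M
    let M∪x-ctrl = Controlled-∪⁅⁆ M-ctrl B∈bs x∈B x∉M 2≤
    pure (M-max (M ∪ ⁅ x ⁆) (p⊆p∪q ⁅ x ⁆) M∪x-ctrl (q⊆p∪q M ⁅ x ⁆ (x∈⁅x⁆ x)))) x∉M

  hull-bound : ∀ {X} → IsHullSet G X → ¬ ¬ (n + excess bs X ≤ ∣ X ∣ + excess bs ⊤)
  hull-bound {X} X-hull = do
    (M , _ , M-ctrl@(X⊆M , bound) , M-max) ← ¬¬-maximal (Controlled X) ((λ x∈X → x∈X) , ≤-refl)
    let M-full : ∀ v → v ∈ M
        M-full = X-hull M X⊆M (maximal-Controlled⇒Convex M-ctrl M-max)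
    pure (begin
      n + excess bs X         ≡⟨ cong (_+ excess bs X) (∣⊤∣≡n n) ⟨
      ∣ ⊤ {n} ∣ + excess bs X ≤⟨ +-monoˡ-≤ (excess bs X) (p⊆q⇒∣p∣≤∣q∣ {p = ⊤} λ {v} _ → M-full v) ⟩
      ∣ M ∣ + excess bs X     ≤⟨ bound ⟩
      ∣ X ∣ + excess bs M     ≤⟨ +-monoʳ-≤ ∣ X ∣ (excess-mono bs λ _ → ∈⊤) ⟩
      ∣ X ∣ + excess bs ⊤     ∎)
    where open ≤-Reasoning

record SpanningTree {n : ℕ} (G : Graph n) (r : Fin n) : Set where
  field
    height       : Fin n → ℕ
    parent       : Fin n → Fin n
    parent-adj   : ∀ {v} → v ≢ r → Adj G v (parent v)
    parent-lower : ∀ {v} → v ≢ r → height (parent v) < height v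

module _ {n : ℕ} (G : Graph n) where
  open Walks G

  ¬¬-spanningTree : Connected G → ∀ r → ¬ ¬ SpanningTree G r
  ¬¬-spanningTree conn r = do
    geodesic ← ¬¬-finite-choice λ v → ¬¬-shortest (conn v r)
    pure (tree geodesic)
    where
    Walk : Fin n → Set
    Walk v = WalkIn G (λ _ → Unit) v r
    Shortest : Fin n → Set
    Shortest v = ∃ λ (w : Walk v) → ∀ (w′ : Walk v) → lengthʷ w ≤ lengthʷ w′
    ¬¬-shortest : ∀ {v} → Walk v → ¬ ¬ Shortest v
    ¬¬-shortest w = do
      (k , (w₀ , k≡∣w₀∣) , k-least) ← ¬¬-least {P = λ k → ∃ λ (w : Walk _) → k ≡ lengthʷ w} (_ , w , refl)
      pure (w₀ , λ w′ → subst (_≤ lengthʷ w′) k≡∣w₀∣ (k-least (w′ , refl)))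
    tree : (∀ v → Shortest v) → SpanningTree G r
    tree geodesic = record
      { height = height ; parent = parent ; parent-adj = proj₁ ∘ descends ; parent-lower = proj₂ ∘ descends }
      where
      height : Fin n → ℕ
      height v = lengthʷ (proj₁ (geodesic v))
      parent : Fin n → Fin n
      parent v with geodesic v
      ... | here _ , _             = r
      ... | step {w = w} _ _ _ , _ = w
      descends : ∀ {v} → v ≢ r → Adj G v (parent v) × height (parent v) < height v
      descends {v} v≢r with geodesic v
      ... | here _ , _                 = ⊥-elim (v≢r refl)
      ... | step {w = w} _ vw rest , _ = vw , s≤s (proj₂ (geodesic w) rest)

module TreeOrder {n : ℕ} {G : Graph n} {r : Fin n} (T : SpanningTree G r) where
  open SpanningTree T
  open Walks G
  open Biconnectivity G

  infix 4 _≼_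
  data _≼_ (y : Fin n) : Fin n → Set where
    ≼-refl   : y ≼ y
    ≼-parent : ∀ {v} → v ≢ r → y ≼ parent v → y ≼ v

  ≼⇒height-≤ : ∀ {y v} → y ≼ v → height y ≤ height v
  ≼⇒height-≤ ≼-refl             = ≤-refl
  ≼⇒height-≤ (≼-parent v≢r y≼p) = ≤-trans (≼⇒height-≤ y≼p) (<⇒≤ (parent-lower v≢r))

  ≼∧≢⇒height-< : ∀ {y v} → y ≼ v → y ≢ v → height y < height v
  ≼∧≢⇒height-< ≼-refl             y≢y = ⊥-elim (y≢y refl)
  ≼∧≢⇒height-< (≼-parent v≢r y≼p) _   = ≤-<-trans (≼⇒height-≤ y≼p) (parent-lower v≢r)

  ≼∧height-≥⇒≡ : ∀ {y v} → y ≼ v → height v ≤ height y → y ≡ v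
  ≼∧height-≥⇒≡ ≼-refl             _     = refl
  ≼∧height-≥⇒≡ (≼-parent v≢r y≼p) hv≤hy = ⊥-elim (<⇒≱ (≤-<-trans (≼⇒height-≤ y≼p) (parent-lower v≢r)) hv≤hy)

  ≼-antisym : ∀ {y v} → y ≼ v → v ≼ y → y ≡ v
  ≼-antisym y≼v v≼y = ≼∧height-≥⇒≡ y≼v (≼⇒height-≤ v≼y)

  ≼-trans : ∀ {a b c} → a ≼ b → b ≼ c → a ≼ c
  ≼-trans a≼b ≼-refl             = a≼b
  ≼-trans a≼b (≼-parent c≢r b≼p) = ≼-parent c≢r (≼-trans a≼b b≼p)

  ≼-total : ∀ {a b v} → a ≼ v → b ≼ v → a ≼ b ⊎ b ≼ a
  ≼-total ≼-refl             b≼v              = inj₂ b≼v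
  ≼-total (≼-parent v≢r a≼p) ≼-refl           = inj₁ (≼-parent v≢r a≼p)
  ≼-total (≼-parent _ a≼p)   (≼-parent _ b≼p) = ≼-total a≼p b≼p

  ≼-parent⁻ : ∀ {z v} → z ≼ v → z ≢ v → z ≼ parent v
  ≼-parent⁻ ≼-refl           z≢z = ⊥-elim (z≢z refl)
  ≼-parent⁻ (≼-parent _ z≼p) _   = z≼p

  root-≼ : ∀ v → r ≼ v
  root-≼ v = climb (suc (height v)) v ≤-refl
    where
    climb : ∀ k v → height v < k → r ≼ v
    climb (suc k) v hv<k with v ≟ᶠ r
    ... | yes refl = ≼-refl
    ... | no v≢r   = ≼-parent v≢r (climb k (parent v) (<-≤-trans (parent-lower v≢r) (≤-pred hv<k)))

  walk-to-ancestor : ∀ {y v} → y ≼ v → WalkIn G (λ x → y ≼ x × x ≼ v) v y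
  walk-to-ancestor ≼-refl             = here (≼-refl , ≼-refl)
  walk-to-ancestor (≼-parent v≢r y≼p) =
    step (≼-parent v≢r y≼p , ≼-refl) (parent-adj v≢r)
         (mapʷ (λ (y≼x , x≼p) → y≼x , ≼-parent v≢r x≼p) (walk-to-ancestor y≼p))

  ¬¬-lowest-common-ancestor : ∀ a b → ¬ ¬ ∃ λ z → z ≼ a × z ≼ b × ∀ {c} → c ≼ a → c ≼ b → c ≼ z
  ¬¬-lowest-common-ancestor a b = do
    (z , (z≼a , z≼b) , z-deepest) ←
      ¬¬-argmin (Flip.totalPreorder ≤-totalPreorder) {P = λ c → c ≼ a × c ≼ b} height
                (r , root-≼ a , root-≼ b)
    pure (z , z≼a , z≼b , λ {c} c≼a c≼b → below-z z≼a (z-deepest (c≼a , c≼b)) c≼a)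
    where
    below-z : ∀ {z c} → z ≼ a → height c ≤ height z → c ≼ a → c ≼ z
    below-z z≼a hc≤hz c≼a with ≼-total c≼a z≼a
    ... | inj₁ c≼z = c≼z
    ... | inj₂ z≼c = subst (_≼ _) (≼∧height-≥⇒≡ z≼c hc≤hz) ≼-refl

  tree-path-ear-Biconn : ∀ {B D a b z} → Biconn G B → a ∈ B → b ∈ B → z ≼ a → z ≼ b →
                         (∀ {c} → c ≼ a → c ≼ b → c ≼ z) →
                         (_∈ D) ≐ (λ y → y ∈ B ⊎ z ≼ y × (y ≼ a ⊎ y ≼ b)) → Biconn G D
  tree-path-ear-Biconn {B} {D} {a} {b} {z} B-bi a∈B b∈B z≼a z≼b z-lca (D⊆ , ⊆D) =
    Biconn-extend B-bi (⊆D ∘ inj₁) reach reach-avoiding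
    where
    on-branch : ∀ {c} → (∀ {x} → x ≼ c → x ≼ a ⊎ x ≼ b) → ∀ {x} → z ≼ x → x ≼ c → x ∈ D
    on-branch side z≼x x≼c = ⊆D (inj₂ (z≼x , side x≼c))

    up : ∀ {c y} → c ∈ B → (∀ {x} → x ≼ c → x ≼ a ⊎ x ≼ b) → z ≼ y → y ≼ c →
         ∃ λ e → e ∈ B × WalkIn G (_∈ D) y e
    up c∈B side z≼y y≼c =
      _ , c∈B , reverseʷ (mapʷ (λ (y≼x , x≼c) → on-branch side (≼-trans z≼y y≼x) x≼c)
                               (walk-to-ancestor y≼c))

    reach : ∀ {y} → y ∈ D → ∃ λ e → e ∈ B × WalkIn G (_∈ D) y e
    reach {y} y∈D with D⊆ y∈D
    ... | inj₁ y∈B              = y , y∈B , here y∈D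
    ... | inj₂ (z≼y , inj₁ y≼a) = up a∈B inj₁ z≼y y≼a
    ... | inj₂ (z≼y , inj₂ y≼b) = up b∈B inj₂ z≼y y≼b

    -- Leave the branch of y upwards if w is not above y on it, and otherwise
    -- go down to z and up the other branch, which w cannot lie on.
    escape : ∀ {a′ b′} → a′ ∈ B → b′ ∈ B → z ≼ b′ → (∀ {c} → c ≼ a′ → c ≼ b′ → c ≼ z) →
             (∀ {x} → z ≼ x → x ≼ a′ → x ∈ D) → (∀ {x} → z ≼ x → x ≼ b′ → x ∈ D) →
             ∀ w {y} → y ≢ w → z ≼ y → y ≼ a′ →
             ¬ ¬ ∃ λ e → e ∈ B × e ≢ w × WalkIn G (λ x → x ∈ D × x ≢ w) y e
    escape {a′} {b′} a′∈B b′∈B z≼b′ lca on-a′ on-b′ w {y} y≢w z≼y y≼a′ = do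
      between? ← ¬¬-excluded-middle {A = y ≼ w × w ≼ a′}
      pure (case between? of λ where
        (no w∉[y,a′]) →
          let y⇝a′ = reverseʷ (mapʷ (λ (y≼x , x≼a′) → on-a′ (≼-trans z≼y y≼x) x≼a′ ,
                                         λ { refl → w∉[y,a′] (y≼x , x≼a′) })
                                    (walk-to-ancestor y≼a′))
          in a′ , a′∈B , proj₂ (endʷ y⇝a′) , y⇝a′
        (yes (y≼w , w≼a′)) →
          let y⇝z = mapʷ (λ (z≼x , x≼y) → on-a′ z≼x (≼-trans x≼y y≼a′) ,
                               λ { refl → y≢w (≼-antisym y≼w x≼y) })
                         (walk-to-ancestor z≼y)
              z⇝b′ = reverseʷ (mapʷ (λ (z≼x , x≼b′) → on-b′ z≼x x≼b′ ,
                                         λ { refl → y≢w (≼-antisym y≼w (≼-trans (lca w≼a′ x≼b′) z≼y)) })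
                                   (walk-to-ancestor z≼b′))
          in b′ , b′∈B , proj₂ (endʷ z⇝b′) , y⇝z ++ʷ z⇝b′)

    reach-avoiding : ∀ w {y} → y ∈ D → y ≢ w →
                     ¬ ¬ ∃ λ e → e ∈ B × e ≢ w × WalkIn G (λ x → x ∈ D × x ≢ w) y e
    reach-avoiding w {y} y∈D y≢w with D⊆ y∈D
    ... | inj₁ y∈B              = pure (y , y∈B , y≢w , here (y∈D , y≢w))
    ... | inj₂ (z≼y , inj₁ y≼a) =
      escape a∈B b∈B z≼b z-lca (on-branch inj₁) (on-branch inj₂) w y≢w z≼y y≼a
    ... | inj₂ (z≼y , inj₂ y≼b) =
      escape b∈B a∈B z≼a (λ c≼b c≼a → z-lca c≼a c≼b) (on-branch inj₂) (on-branch inj₁) w y≢w z≼y y≼b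

  -- B together with the tree path from v through the lowest common ancestor of v and u to u
  -- is biconnected, hence inside B, and that path passes through parent v.
  parent-in-block : ∀ {B u v} → IsBlock G B → u ∈ B → (∀ {y} → y ∈ B → height u ≤ height y) →
                    v ∈ B → v ≢ u → v ≢ r × parent v ∈ B
  parent-in-block {B} {u} {v} (B-bi , B-max) u∈B u-lowest v∈B v≢u =
    v≢r , decidable-stable (parent v ∈? B) do
      (z , z≼v , z≼u , z-lca) ← ¬¬-lowest-common-ancestor v u
      (D , D≐) ← ¬¬-comprehension (λ y → y ∈ B ⊎ z ≼ y × (y ≼ v ⊎ y ≼ u))
      let D-bi = tree-path-ear-Biconn B-bi v∈B u∈B z≼v z≼u z-lca D≐
          z≢v = λ { refl → v⋠u z≼u }
      pure (B-max D (proj₂ D≐ ∘ inj₁) D-bi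
                  (proj₂ D≐ (inj₂ (≼-parent⁻ z≼v z≢v , inj₁ (≼-parent v≢r ≼-refl)))))
    where
    v⋠u : ¬ v ≼ u
    v⋠u v≼u = <⇒≱ (≼∧≢⇒height-< v≼u v≢u) (u-lowest v∈B)
    v≢r : v ≢ r
    v≢r refl = v⋠u (root-≼ u)

module BlockCount {n : ℕ} (G : Graph n) {r : Fin n} (T : SpanningTree G r) where
  open SpanningTree T
  open TreeOrder T
  open Biconnectivity G

  HangsIn : Subset n → Fin n → Set
  HangsIn B x = x ∈ B × x ≢ r × parent x ∈ B

  hangs-in-unique : ∀ {B₁ B₂ x} → IsBlock G B₁ → IsBlock G B₂ → HangsIn B₁ x → HangsIn B₂ x → B₁ ≡ B₂
  hangs-in-unique {x = x} B₁-block B₂-block (x∈B₁ , x≢r , px∈B₁) (x∈B₂ , _ , px∈B₂) =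
    two-common-vertices⇒≡ B₁-block B₂-block x≢px x∈B₁ px∈B₁ x∈B₂ px∈B₂
    where
    x≢px : x ≢ parent x
    x≢px x≡px = adj-irrefl G x (subst (Adj G x) (sym x≡px) (parent-adj x≢r))

  ¬¬-hanging-part : ∀ {B} → IsBlock G B → 2 ≤ ∣ B ∣ →
                    ¬ ¬ ∃ λ H → (∀ {x} → x ∈ H → HangsIn B x) × suc (∣ B ∣ ∸ 2) ≤ ∣ H ∣
  ¬¬-hanging-part {B} B-block@((((v , v∈B) , _) , _) , _) 2≤∣B∣ = do
    (u , u∈B , u-lowest) ← ¬¬-argmin ≤-totalPreorder {P = _∈ B} height (v , v∈B)
    let (H , H⊆ , ⊆H) = comprehension (λ y → y ∈? B ×-dec ¬? (y ≟ᶠ u))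
        hangs : ∀ {x} → x ∈ H → HangsIn B x
        hangs x∈H = let (x∈B , x≢u) = H⊆ x∈H
                    in x∈B , parent-in-block B-block u∈B u-lowest x∈B x≢u
    pure (H , (λ {x} → hangs {x}) , ∸2-bound 2≤∣B∣ (⊆∪⁅x⁆⇒∣p∣≤1+∣q∣ (⊆H ∘₂ _,_)))
    where
    ∸2-bound : ∀ {b d} → 2 ≤ b → b ≤ suc d → suc (b ∸ 2) ≤ d
    ∸2-bound (s≤s (s≤s _)) (s≤s b≤d) = b≤d

  ¬¬-hanging-union : (∀ v → ∃ (Adj G v)) → ∀ {bs} → Unique bs → All (IsBlock G) bs →
    ¬ ¬ ∃ λ U → (∀ {x} → x ∈ U → ∃ λ B → B ∈ₗ bs × HangsIn B x) × excess bs ⊤ + length bs ≤ ∣ U ∣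
  ¬¬-hanging-union _ {[]} [] [] = pure (∅ , (λ {x} x∈∅ → ⊥-elim (∉⊥ x∈∅)) , z≤n)
  ¬¬-hanging-union neighbour {B ∷ bs} (B∉bs ∷ unique)
                   (B-block@((((v , v∈B) , _) , _) , _) ∷ blocks) = do
    (H , H-hangs , H-big) ← ¬¬-hanging-part B-block (block-size≥2 B-block v∈B (proj₂ (neighbour v)))
    (U , U-hangs , U-big) ← ¬¬-hanging-union neighbour unique blocks
    let hangs : ∀ {x} → x ∈ H ∪ U → ∃ λ B′ → B′ ∈ₗ B ∷ bs × HangsIn B′ x
        hangs x∈H∪U = case x∈p∪q⁻ H U x∈H∪U of λ where
          (inj₁ x∈H) → B , here refl , H-hangs x∈H
          (inj₂ x∈U) → let (B′ , B′∈bs , x-hangs) = U-hangs x∈U in B′ , there B′∈bs , x-hangs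
        disjoint : ∀ {x} → x ∈ H → x ∉ U
        disjoint x∈H x∈U =
          let (B′ , B′∈bs , x-hangs) = U-hangs x∈U
          in All.lookup B∉bs B′∈bs
               (hangs-in-unique B-block (All.lookup blocks B′∈bs) (H-hangs x∈H) x-hangs)
    pure (H ∪ U , (λ {x} → hangs {x}) , (begin
      (∣ B ∩ ⊤ ∣ ∸ 2) + excess bs ⊤ + suc (length bs) ≡⟨ cong (λ k → (∣ k ∣ ∸ 2) + _ + _) (∩-identityʳ B) ⟩
      (∣ B ∣ ∸ 2) + excess bs ⊤ + suc (length bs)     ≡⟨ +-suc _ (length bs) ⟩
      suc ((∣ B ∣ ∸ 2) + excess bs ⊤ + length bs)     ≡⟨ cong suc (+-assoc (∣ B ∣ ∸ 2) _ _) ⟩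
      suc (∣ B ∣ ∸ 2) + (excess bs ⊤ + length bs)     ≤⟨ +-mono-≤ H-big U-big ⟩
      ∣ H ∣ + ∣ U ∣                                   ≤⟨ disjoint⇒∣p∣+∣q∣≤∣p∪q∣ H U disjoint ⟩
      ∣ H ∪ U ∣                                       ∎))
    where open ≤-Reasoning

  block-count : (∀ v → ∃ (Adj G v)) → ∀ {bs} → Unique bs → All (IsBlock G) bs →
                ¬ ¬ (excess bs ⊤ + length bs < n)
  block-count neighbour unique blocks = do
    (U , U-hangs , U-big) ← ¬¬-hanging-union neighbour unique blocks
    let r∉U : r ∉ U
        r∉U r∈U = let (_ , _ , _ , r≢r , _) = U-hangs r∈U in r≢r refl
    pure (≤-<-trans U-big (subst (∣ U ∣ <_) (∣⊤∣≡n n) (p⊂q⇒∣p∣<∣q∣ ((λ _ → ∈⊤) , r , ∈⊤ , r∉U))))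

another-vertex : ∀ {m} (v : Fin (suc (suc m))) → ∃ λ u → u ≢ v
another-vertex zero    = suc zero , λ ()
another-vertex (suc _) = zero , λ ()

corollary3 : ∀ (n : ℕ) (G : Graph n) → 2 ≤ n → Connected G →
             ∀ (p : ℕ) → HasBlocks G p →
             ∀ (h : ℕ) → IsHullNumber G h → suc p ≤ h
corollary3 zero          _ () _ _ _ _ _
corollary3 (suc zero)    _ (s≤s ()) _ _ _ _ _
corollary3 n@(suc (suc _)) G _ conn _ (bs , refl , unique , blocks , complete)
           _ ((X , X-hull , refl) , _) =
  decidable-stable (suc (length bs) ≤? ∣ X ∣) do
    T ← ¬¬-spanningTree G conn zero
    few-blocks ← BlockCount.block-count G T neighbour unique blocks
    hull ← HullBound.hull-bound G bs complete X-hull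
    pure (+-cancelˡ-≤ (excess bs ⊤) _ _ (begin
      excess bs ⊤ + suc (length bs) ≡⟨ +-suc _ _ ⟩
      suc (excess bs ⊤ + length bs) ≤⟨ few-blocks ⟩
      n                             ≤⟨ m≤m+n n (excess bs X) ⟩
      n + excess bs X               ≤⟨ hull ⟩
      ∣ X ∣ + excess bs ⊤           ≡⟨ +-comm ∣ X ∣ _ ⟩
      excess bs ⊤ + ∣ X ∣           ∎))
  where
  open ≤-Reasoning
  neighbour : ∀ v → ∃ (Adj G v)
  neighbour v = let (u , u≢v) = another-vertex v in Walks.∃-neighbour G (conn v u) (u≢v ∘ sym)
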